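{- Let $p$ and $q$ be distinct primes. Then $$(1-x^{p\langle p^{ -1}\rangle_q})+(x^{pq}-x^{q\langle q^{ -1}\rangle_p})\equiv 1-x \pmod{(1-x^p)(1-x^q)}.$$
   Context: For a rational $c=a/b$ with $b$ coprime to $m$, $\langle c\rangle_m$ is the smallest nonnegative integer $k$ with $kb\equiv a\pmod m$. -}

module Defs where

open import Data.Nat as ℕ using (ℕ; zero; suc; _<_; NonZero)
open import Data.Nat.DivMod using (_%_)
open import Data.Integer as ℤ using (ℤ; +_)
open import Data.List using (List; []; _∷_; map; replicate; _++_)
open import Data.Product using (∃)
open import Relation.Binary.PropositionalEquality using (_≡_; _≢_)

-- ⟨ a / b ⟩_m : the smallest nonnegative integer k with k b ≡ a (mod m).
-- We state it as a predicate "k is ⟨a/b⟩_m" (for natural a, b, m ≠ 0).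

record IsBracket (a b m : ℕ) .{{_ : NonZero m}} (k : ℕ) : Set where
  field
    solves : (k ℕ.* b) % m ≡ a % m
    least  : ∀ j → j < k → (j ℕ.* b) % m ≢ a % m

-- Integer polynomials as coefficient lists (constant term first).

Poly : Set
Poly = List ℤ

infixl 6 _+ₚ_ _-ₚ_
infixl 7 _*ₚ_

_+ₚ_ : Poly → Poly → Poly
[] +ₚ g = g
(a ∷ f) +ₚ [] = a ∷ f
(a ∷ f) +ₚ (b ∷ g) = (a ℤ.+ b) ∷ (f +ₚ g)

-ₚ_ : Poly → Poly
-ₚ f = map ℤ.-_ f

_-ₚ_ : Poly → Poly → Poly
f -ₚ g = f +ₚ (-ₚ g)

_*ₚ_ : Poly → Poly → Poly
[] *ₚ g = []
(a ∷ f) *ₚ g = map (a ℤ.*_) g +ₚ (+ 0 ∷ (f *ₚ g))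

oneₚ : Poly
oneₚ = + 1 ∷ []

X^ : ℕ → Poly
X^ n = replicate n (+ 0) ++ (+ 1 ∷ [])

coeff : Poly → ℕ → ℤ
coeff [] n = + 0
coeff (a ∷ f) zero = a
coeff (a ∷ f) (suc n) = coeff f n

-- equality of polynomials (coefficientwise; ignores trailing zeros)
_≈ₚ_ : Poly → Poly → Set
f ≈ₚ g = ∀ n → coeff f n ≡ coeff g n

_∣ₚ_ : Poly → Poly → Set
d ∣ₚ f = ∃ λ h → f ≈ₚ (d *ₚ h)

_≡_[modₚ_] : Poly → Poly → Poly → Set
f ≡ g [modₚ d ] = d ∣ₚ (f -ₚ g)

-- Write pk = 1 + qm and ql = 1 + pn. Then (k + n)p = (m + l)q, so q divides k + n, and the bounds
-- 0 < k, n < q force k + n = q, i.e. pq = 1 + qm + pn. With a = qm and b = pn the difference of the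
-- two sides is  x − x^(1+a) + x^(1+a+b) − x^(1+b) = x (1 − x^a)(1 − x^b),  and 1 − x^q divides
-- 1 − x^(qm), 1 − x^p divides 1 − x^(pn).
module Submission where

open import Defs
open import Data.Nat using (ℕ; _*_)
open import Data.Nat.Primality using (Prime; prime⇒nonZero)
open import Relation.Binary.PropositionalEquality using (_≢_)
open import Data.Nat as ℕ using (zero; suc; _+_; _∸_; _<_; NonZero; nonTrivial⇒n>1)
import Data.Nat.Properties as ℕ
open import Data.Nat.DivMod using (_%_; _/_; m≡m%n+[m/n]*n; [m+kn]%n≡m%n; m<n⇒m%n≡m)
open import Data.Nat.Divisibility using (_∣_; _∤_; divides)
open import Data.Nat.Primality using (euclidsLemma; prime⇒irreducible; prime⇒nonTrivial)
open import Data.Integer as ℤ using (ℤ; +_)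
import Data.Integer.Properties as ℤ
open import Data.List using ([]; _∷_; map)
open import Data.Maybe using (Maybe; just; nothing)
open import Data.Product using (_,_)
open import Data.Sum using (inj₁; inj₂)
open import Level using (0ℓ)
open import Relation.Nullary using (yes; no; contradiction)
open import Relation.Binary.PropositionalEquality
  using (_≡_; refl; cong; cong₂; sym; trans; subst; module ≡-Reasoning)
open import Relation.Binary.Bundles using (Setoid)
open import Algebra.Bundles using (CommutativeRing)
open import Tactic.RingSolver.Core.AlmostCommutativeRing using (AlmostCommutativeRing; fromCommutativeRing)
open import Tactic.RingSolver using (solve-∀)

IsBracket⇒< : ∀ {a b m k} .{{_ : NonZero m}} → IsBracket a b m k → k < m
IsBracket⇒< {b = b} {m} {k} isBracket with k ℕ.<? m
... | yes k<m = k<m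
... | no  k≮m = contradiction (trans %-shift-invariant solves) (least (k ∸ m) k∸m<k)
  where
  open IsBracket isBracket
  k∸m+m≡k : k ∸ m + m ≡ k
  k∸m+m≡k = ℕ.m∸n+n≡m (ℕ.≮⇒≥ k≮m)
  k∸m<k : k ∸ m < k
  k∸m<k = subst (k ∸ m <_) k∸m+m≡k (ℕ.m<m+n (k ∸ m) (ℕ.>-nonZero⁻¹ m))
  %-shift-invariant : ((k ∸ m) * b) % m ≡ (k * b) % m
  %-shift-invariant = begin
    ((k ∸ m) * b) % m           ≡⟨ [m+kn]%n≡m%n ((k ∸ m) * b) b m ⟨
    ((k ∸ m) * b + b * m) % m   ≡⟨ cong (λ c → ((k ∸ m) * b + c) % m) (ℕ.*-comm b m) ⟩
    ((k ∸ m) * b + m * b) % m   ≡⟨ cong (_% m) (ℕ.*-distribʳ-+ b (k ∸ m) m) ⟨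
    ((k ∸ m + m) * b) % m       ≡⟨ cong (λ c → (c * b) % m) k∸m+m≡k ⟩
    (k * b) % m                 ∎
    where open ≡-Reasoning

IsBracket-1⇒k*b≡1+[k*b/m]*m : ∀ {b m k} .{{_ : NonZero m}} → 1 < m → IsBracket 1 b m k →
                               k * b ≡ suc (k * b / m * m)
IsBracket-1⇒k*b≡1+[k*b/m]*m {b} {m} {k} 1<m isBracket =
  trans (m≡m%n+[m/n]*n (k * b) m) (cong (_+ k * b / m * m) (trans solves (m<n⇒m%n≡m 1<m)))
  where open IsBracket isBracket

m∣n∧0<n<m+m⇒n≡m : ∀ {m n} → m ∣ n → 0 < n → n < m + m → n ≡ m
m∣n∧0<n<m+m⇒n≡m     (divides zero          refl) ()
m∣n∧0<n<m+m⇒n≡m {m} (divides (suc zero)    refl) _ _    = ℕ.+-identityʳ m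
m∣n∧0<n<m+m⇒n≡m {m} (divides (suc (suc t)) refl) _ n<2m =
  contradiction n<2m (ℕ.≤⇒≯ (ℕ.+-monoʳ-≤ m (ℕ.m≤m+n m (t * m))))

prime∤prime : ∀ {p q} → Prime p → Prime q → p ≢ q → q ∤ p
prime∤prime {p} {q} p-prime q-prime p≢q q∣p with prime⇒irreducible p-prime q∣p
... | inj₁ q≡1 = contradiction q≡1 (ℕ.>⇒≢ (nonTrivial⇒n>1 q {{prime⇒nonTrivial q-prime}}))
... | inj₂ q≡p = p≢q (sym q≡p)

-- (k + n) p = (m + l) q, so k + n is a multiple of q strictly between 0 and 2q.
inverses-sum : ∀ {p q k l m n} → Prime q → q ∤ p → k < q → l < p →
               k * p ≡ suc (m * q) → l * q ≡ suc (n * p) → k + n ≡ q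
inverses-sum {p} {q} {k} {l} {m} {n} q-prime q∤p k<q l<p kp≡1+mq lq≡1+np =
  m∣n∧0<n<m+m⇒n≡m q∣k+n (ℕ.<-≤-trans (0<k kp≡1+mq) (ℕ.m≤m+n k n)) (ℕ.+-mono-< k<q n<q)
  where
  open ≡-Reasoning
  0<k : ∀ {k x} → k * p ≡ suc x → 0 < k
  0<k {suc _} _ = ℕ.z<s
  [k+n]p≡[m+l]q : (k + n) * p ≡ (m + l) * q
  [k+n]p≡[m+l]q = ℕ.suc-injective (begin
    suc ((k + n) * p)     ≡⟨ cong suc (ℕ.*-distribʳ-+ p k n) ⟩
    suc (k * p + n * p)   ≡⟨ ℕ.+-suc (k * p) (n * p) ⟨
    k * p + suc (n * p)   ≡⟨ cong (λ c → k * p + c) lq≡1+np ⟨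
    k * p + l * q         ≡⟨ cong (_+ l * q) kp≡1+mq ⟩
    suc (m * q + l * q)   ≡⟨ cong suc (ℕ.*-distribʳ-+ q m l) ⟨
    suc ((m + l) * q)     ∎)
  q∣k+n : q ∣ k + n
  q∣k+n with euclidsLemma (k + n) p q-prime (divides (m + l) [k+n]p≡[m+l]q)
  ... | inj₁ q∣k+n = q∣k+n
  ... | inj₂ q∣p   = contradiction q∣p q∤p
  n<q : n < q
  n<q = ℕ.*-cancelʳ-< p n q (ℕ.<-trans (subst (n * p <_) (sym lq≡1+np) (ℕ.n<1+n (n * p)))
                                       (subst (l * q <_) (ℕ.*-comm p q)
                                              (ℕ.*-monoˡ-< q {{prime⇒nonZero q-prime}} l<p)))

scale : ℤ → Poly → Poly
scale a = map (a ℤ.*_)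

coeff-+ₚ : ∀ f g n → coeff (f +ₚ g) n ≡ coeff f n ℤ.+ coeff g n
coeff-+ₚ []      g       n       = sym (ℤ.+-identityˡ _)
coeff-+ₚ (a ∷ f) []      n       = sym (ℤ.+-identityʳ _)
coeff-+ₚ (a ∷ f) (b ∷ g) zero    = refl
coeff-+ₚ (a ∷ f) (b ∷ g) (suc n) = coeff-+ₚ f g n

coeff--ₚ : ∀ f n → coeff (-ₚ f) n ≡ ℤ.- coeff f n
coeff--ₚ []      n       = refl
coeff--ₚ (a ∷ f) zero    = refl
coeff--ₚ (a ∷ f) (suc n) = coeff--ₚ f n

coeff-scale : ∀ a g n → coeff (scale a g) n ≡ a ℤ.* coeff g n
coeff-scale a []      n       = sym (ℤ.*-zeroʳ a)
coeff-scale a (b ∷ g) zero    = refl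
coeff-scale a (b ∷ g) (suc n) = coeff-scale a g n

-- _≈ₚ_ wrapped in a record, so that the polynomials can be inferred from an equality proof.
infix 4 _≋_
record _≋_ (f g : Poly) : Set where
  constructor mk≋
  field coeff-≡ : f ≈ₚ g
open _≋_

≋-refl : ∀ {f} → f ≋ f
≋-refl = mk≋ λ _ → refl

≋-sym : ∀ {f g} → f ≋ g → g ≋ f
≋-sym f≋g = mk≋ λ n → sym (coeff-≡ f≋g n)

≋-trans : ∀ {f g h} → f ≋ g → g ≋ h → f ≋ h
≋-trans f≋g g≋h = mk≋ λ n → trans (coeff-≡ f≋g n) (coeff-≡ g≋h n)

≋-setoid : Setoid 0ℓ 0ℓ
≋-setoid = record
  { Carrier = Poly ; _≈_ = _≋_
  ; isEquivalence = record { refl = ≋-refl ; sym = ≋-sym ; trans = ≋-trans } }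

open import Relation.Binary.Reasoning.Setoid ≋-setoid

∷-cong : ∀ {a b f g} → a ≡ b → f ≋ g → (a ∷ f) ≋ (b ∷ g)
∷-cong a≡b f≋g = mk≋ λ { zero → a≡b ; (suc n) → coeff-≡ f≋g n }

+ₚ-cong : ∀ {f f′ g g′} → f ≋ f′ → g ≋ g′ → (f +ₚ g) ≋ (f′ +ₚ g′)
+ₚ-cong {f} {f′} {g} {g′} f≋f′ g≋g′ = mk≋ λ n →
  trans (coeff-+ₚ f g n) (trans (cong₂ ℤ._+_ (coeff-≡ f≋f′ n) (coeff-≡ g≋g′ n)) (sym (coeff-+ₚ f′ g′ n)))

+ₚ-assoc : ∀ f g h → ((f +ₚ g) +ₚ h) ≋ (f +ₚ (g +ₚ h))
+ₚ-assoc f g h = mk≋ λ n → trans (coeff-+ₚ (f +ₚ g) h n) (trans (cong (ℤ._+ coeff h n) (coeff-+ₚ f g n))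
  (trans (ℤ.+-assoc (coeff f n) _ _)
    (sym (trans (coeff-+ₚ f (g +ₚ h) n) (cong (λ c → coeff f n ℤ.+ c) (coeff-+ₚ g h n))))))

+ₚ-comm : ∀ f g → (f +ₚ g) ≋ (g +ₚ f)
+ₚ-comm f g = mk≋ λ n → trans (coeff-+ₚ f g n) (trans (ℤ.+-comm (coeff f n) _) (sym (coeff-+ₚ g f n)))

+ₚ-identityʳ : ∀ f → (f +ₚ []) ≋ f
+ₚ-identityʳ f = mk≋ λ n → trans (coeff-+ₚ f [] n) (ℤ.+-identityʳ _)

-ₚ‿inverseˡ : ∀ f → ((-ₚ f) +ₚ f) ≋ []
-ₚ‿inverseˡ f = mk≋ λ n →
  trans (coeff-+ₚ (-ₚ f) f n) (trans (cong (ℤ._+ coeff f n) (coeff--ₚ f n)) (ℤ.+-inverseˡ (coeff f n)))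

-ₚ‿cong : ∀ {f g} → f ≋ g → (-ₚ f) ≋ (-ₚ g)
-ₚ‿cong {f} {g} f≋g = mk≋ λ n → trans (coeff--ₚ f n) (trans (cong ℤ.-_ (coeff-≡ f≋g n)) (sym (coeff--ₚ g n)))

+ₚ-middle-swap : ∀ f g h k → ((f +ₚ g) +ₚ (h +ₚ k)) ≋ ((f +ₚ h) +ₚ (g +ₚ k))
+ₚ-middle-swap f g h k = begin
  (f +ₚ g) +ₚ (h +ₚ k)   ≈⟨ +ₚ-assoc f g (h +ₚ k) ⟩
  f +ₚ (g +ₚ (h +ₚ k))   ≈⟨ +ₚ-cong (≋-refl {f}) (≋-sym (+ₚ-assoc g h k)) ⟩
  f +ₚ ((g +ₚ h) +ₚ k)   ≈⟨ +ₚ-cong (≋-refl {f}) (+ₚ-cong (+ₚ-comm g h) ≋-refl) ⟩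
  f +ₚ ((h +ₚ g) +ₚ k)   ≈⟨ +ₚ-cong (≋-refl {f}) (+ₚ-assoc h g k) ⟩
  f +ₚ (h +ₚ (g +ₚ k))   ≈⟨ ≋-sym (+ₚ-assoc f h (g +ₚ k)) ⟩
  (f +ₚ h) +ₚ (g +ₚ k)   ∎

scale-cong : ∀ a {g h} → g ≋ h → scale a g ≋ scale a h
scale-cong a {g} {h} g≋h = mk≋ λ n →
  trans (coeff-scale a g n) (trans (cong (a ℤ.*_) (coeff-≡ g≋h n)) (sym (coeff-scale a h n)))

scale-zero : ∀ g → scale (+ 0) g ≋ []
scale-zero g = mk≋ λ n → trans (coeff-scale (+ 0) g n) (ℤ.*-zeroˡ (coeff g n))

scale-distrib-+ₚ : ∀ a g h → scale a (g +ₚ h) ≋ (scale a g +ₚ scale a h)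
scale-distrib-+ₚ a g h = mk≋ λ n → trans (coeff-scale a (g +ₚ h) n) (trans (cong (a ℤ.*_) (coeff-+ₚ g h n))
  (trans (ℤ.*-distribˡ-+ a _ _) (sym (trans (coeff-+ₚ (scale a g) (scale a h) n)
    (cong₂ ℤ._+_ (coeff-scale a g n) (coeff-scale a h n))))))

scale-scale : ∀ a b h → scale a (scale b h) ≋ scale (a ℤ.* b) h
scale-scale a b h = mk≋ λ n → trans (coeff-scale a (scale b h) n) (trans (cong (a ℤ.*_) (coeff-scale b h n))
  (trans (sym (ℤ.*-assoc a b _)) (sym (coeff-scale (a ℤ.* b) h n))))

*ₚ-congˡ : ∀ f {g h} → g ≋ h → (f *ₚ g) ≋ (f *ₚ h)
*ₚ-congˡ []      g≋h = ≋-refl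
*ₚ-congˡ (a ∷ f) g≋h = +ₚ-cong (scale-cong a g≋h) (∷-cong refl (*ₚ-congˡ f g≋h))

*ₚ-zeroʳ : ∀ f → (f *ₚ []) ≋ []
*ₚ-zeroʳ []      = ≋-refl
*ₚ-zeroʳ (a ∷ f) = mk≋ λ { zero → refl ; (suc n) → coeff-≡ (*ₚ-zeroʳ f) n }

0∷-*ₚ : ∀ f g → ((+ 0 ∷ f) *ₚ g) ≋ (+ 0 ∷ (f *ₚ g))
0∷-*ₚ f g = +ₚ-cong (scale-zero g) (≋-refl {+ 0 ∷ (f *ₚ g)})

*ₚ-∷ : ∀ g a f → (g *ₚ (a ∷ f)) ≋ (scale a g +ₚ (+ 0 ∷ (g *ₚ f)))
*ₚ-∷ []      a f = mk≋ λ { zero → refl ; (suc n) → refl }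
*ₚ-∷ (b ∷ g) a f = ∷-cong (cong (ℤ._+ + 0) (ℤ.*-comm b a)) (begin
  scale b f +ₚ (g *ₚ (a ∷ f))                          ≈⟨ +ₚ-cong (≋-refl {scale b f}) (*ₚ-∷ g a f) ⟩
  scale b f +ₚ (scale a g +ₚ (+ 0 ∷ (g *ₚ f)))         ≈⟨ ≋-sym (+ₚ-assoc (scale b f) (scale a g) _) ⟩
  (scale b f +ₚ scale a g) +ₚ (+ 0 ∷ (g *ₚ f))         ≈⟨ +ₚ-cong (+ₚ-comm (scale b f) (scale a g)) ≋-refl ⟩
  (scale a g +ₚ scale b f) +ₚ (+ 0 ∷ (g *ₚ f))         ≈⟨ +ₚ-assoc (scale a g) (scale b f) _ ⟩
  scale a g +ₚ (scale b f +ₚ (+ 0 ∷ (g *ₚ f)))         ∎)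

*ₚ-comm : ∀ f g → (f *ₚ g) ≋ (g *ₚ f)
*ₚ-comm []      g = ≋-sym (*ₚ-zeroʳ g)
*ₚ-comm (a ∷ f) g = ≋-trans (+ₚ-cong (≋-refl {scale a g}) (∷-cong refl (*ₚ-comm f g))) (≋-sym (*ₚ-∷ g a f))

*ₚ-cong : ∀ {f f′ g g′} → f ≋ f′ → g ≋ g′ → (f *ₚ g) ≋ (f′ *ₚ g′)
*ₚ-cong {f} {f′} {g} {g′} f≋f′ g≋g′ = begin
  f *ₚ g    ≈⟨ *ₚ-comm f g ⟩
  g *ₚ f    ≈⟨ *ₚ-congˡ g f≋f′ ⟩
  g *ₚ f′   ≈⟨ *ₚ-comm g f′ ⟩
  f′ *ₚ g   ≈⟨ *ₚ-congˡ f′ g≋g′ ⟩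
  f′ *ₚ g′  ∎

*ₚ-identityˡ : ∀ f → (oneₚ *ₚ f) ≋ f
*ₚ-identityˡ f = mk≋ λ n → trans (coeff-+ₚ (scale (+ 1) f) (+ 0 ∷ []) n)
  (trans (cong₂ ℤ._+_ (coeff-scale (+ 1) f n) (coeff-zero n)) (trans (ℤ.+-identityʳ _) (ℤ.*-identityˡ _)))
  where
  coeff-zero : ∀ n → coeff (+ 0 ∷ []) n ≡ + 0
  coeff-zero zero    = refl
  coeff-zero (suc n) = refl

*ₚ-distribˡ-+ₚ : ∀ f g h → (f *ₚ (g +ₚ h)) ≋ ((f *ₚ g) +ₚ (f *ₚ h))
*ₚ-distribˡ-+ₚ []      g h = ≋-refl
*ₚ-distribˡ-+ₚ (a ∷ f) g h = begin
  scale a (g +ₚ h) +ₚ (+ 0 ∷ (f *ₚ (g +ₚ h)))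
    ≈⟨ +ₚ-cong (scale-distrib-+ₚ a g h) (∷-cong refl (*ₚ-distribˡ-+ₚ f g h)) ⟩
  (scale a g +ₚ scale a h) +ₚ ((+ 0 ∷ (f *ₚ g)) +ₚ (+ 0 ∷ (f *ₚ h)))
    ≈⟨ +ₚ-middle-swap (scale a g) (scale a h) _ _ ⟩
  (scale a g +ₚ (+ 0 ∷ (f *ₚ g))) +ₚ (scale a h +ₚ (+ 0 ∷ (f *ₚ h)))
    ∎

*ₚ-distribʳ-+ₚ : ∀ h f g → ((f +ₚ g) *ₚ h) ≋ ((f *ₚ h) +ₚ (g *ₚ h))
*ₚ-distribʳ-+ₚ h f g = begin
  (f +ₚ g) *ₚ h          ≈⟨ *ₚ-comm (f +ₚ g) h ⟩
  h *ₚ (f +ₚ g)          ≈⟨ *ₚ-distribˡ-+ₚ h f g ⟩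
  (h *ₚ f) +ₚ (h *ₚ g)   ≈⟨ +ₚ-cong (*ₚ-comm h f) (*ₚ-comm h g) ⟩
  (f *ₚ h) +ₚ (g *ₚ h)   ∎

scale-*ₚ : ∀ a g h → (scale a g *ₚ h) ≋ scale a (g *ₚ h)
scale-*ₚ a []      h = ≋-refl
scale-*ₚ a (b ∷ g) h = begin
  scale (a ℤ.* b) h +ₚ (+ 0 ∷ (scale a g *ₚ h))
    ≈⟨ +ₚ-cong (≋-sym (scale-scale a b h)) (∷-cong (sym (ℤ.*-zeroʳ a)) (scale-*ₚ a g h)) ⟩
  scale a (scale b h) +ₚ scale a (+ 0 ∷ (g *ₚ h))
    ≈⟨ ≋-sym (scale-distrib-+ₚ a (scale b h) _) ⟩
  scale a (scale b h +ₚ (+ 0 ∷ (g *ₚ h)))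
    ∎

*ₚ-assoc : ∀ f g h → ((f *ₚ g) *ₚ h) ≋ (f *ₚ (g *ₚ h))
*ₚ-assoc []      g h = ≋-refl
*ₚ-assoc (a ∷ f) g h = begin
  (scale a g +ₚ (+ 0 ∷ (f *ₚ g))) *ₚ h
    ≈⟨ *ₚ-distribʳ-+ₚ h (scale a g) _ ⟩
  (scale a g *ₚ h) +ₚ ((+ 0 ∷ (f *ₚ g)) *ₚ h)
    ≈⟨ +ₚ-cong (scale-*ₚ a g h) (≋-trans (0∷-*ₚ (f *ₚ g) h) (∷-cong refl (*ₚ-assoc f g h))) ⟩
  scale a (g *ₚ h) +ₚ (+ 0 ∷ (f *ₚ (g *ₚ h)))
    ∎

ℤ[x] : CommutativeRing 0ℓ 0ℓ
ℤ[x] = record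
  { Carrier = Poly ; _≈_ = _≋_ ; _+_ = _+ₚ_ ; _*_ = _*ₚ_ ; -_ = -ₚ_ ; 0# = [] ; 1# = oneₚ
  ; isCommutativeRing = record
    { isRing = record
      { +-isAbelianGroup = record
        { isGroup = record
          { isMonoid = record
            { isSemigroup = record
              { isMagma = record { isEquivalence = Setoid.isEquivalence ≋-setoid ; ∙-cong = +ₚ-cong }
              ; assoc = +ₚ-assoc }
            ; identity = (λ _ → ≋-refl) , +ₚ-identityʳ }
          ; inverse = -ₚ‿inverseˡ , λ f → ≋-trans (+ₚ-comm f (-ₚ f)) (-ₚ‿inverseˡ f)
          ; ⁻¹-cong = -ₚ‿cong }
        ; comm = +ₚ-comm }
      ; *-cong = *ₚ-cong
      ; *-assoc = *ₚ-assoc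
      ; *-identity = *ₚ-identityˡ , λ f → ≋-trans (*ₚ-comm f oneₚ) (*ₚ-identityˡ f)
      ; distrib = *ₚ-distribˡ-+ₚ , *ₚ-distribʳ-+ₚ }
    ; *-comm = *ₚ-comm } }

-- The solver needs a (partial) zero test to prune its normal forms.
ℤ[x]-almost : AlmostCommutativeRing 0ℓ 0ℓ
ℤ[x]-almost = fromCommutativeRing ℤ[x] isZero?
  where
  isZero? : ∀ f → Maybe ([] ≋ f)
  isZero? [] = just ≋-refl
  isZero? (+ zero ∷ f) with isZero? f
  ... | just []≋f = just (mk≋ λ { zero → refl ; (suc n) → coeff-≡ []≋f n })
  ... | nothing   = nothing
  isZero? (_ ∷ f) = nothing

X^-+ : ∀ m n → X^ (m + n) ≋ (X^ m *ₚ X^ n)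
X^-+ zero    n = ≋-sym (*ₚ-identityˡ (X^ n))
X^-+ (suc m) n = ≋-trans (∷-cong refl (X^-+ m n)) (≋-sym (0∷-*ₚ (X^ m) (X^ n)))

geometricSum : ℕ → ℕ → Poly
geometricSum d zero    = []
geometricSum d (suc m) = oneₚ +ₚ (X^ d *ₚ geometricSum d m)

one-X^-*-factorisation : ∀ d m → (oneₚ -ₚ X^ (d * m)) ≋ ((oneₚ -ₚ X^ d) *ₚ geometricSum d m)
one-X^-*-factorisation d zero    rewrite ℕ.*-zeroʳ d =
  ≋-trans (mk≋ λ { zero → refl ; (suc n) → refl }) (≋-sym (*ₚ-zeroʳ (oneₚ -ₚ X^ d)))
one-X^-*-factorisation d (suc m) rewrite ℕ.*-suc d m = begin
  oneₚ -ₚ X^ (d + d * m)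
    ≈⟨ +ₚ-cong (≋-refl {oneₚ}) (-ₚ‿cong (X^-+ d (d * m))) ⟩
  oneₚ -ₚ (X^ d *ₚ X^ (d * m))
    ≈⟨ telescope (X^ d) (X^ (d * m)) ⟩
  (oneₚ -ₚ X^ d) +ₚ (X^ d *ₚ (oneₚ -ₚ X^ (d * m)))
    ≈⟨ +ₚ-cong (≋-refl {oneₚ -ₚ X^ d}) (*ₚ-cong (≋-refl {X^ d}) (one-X^-*-factorisation d m)) ⟩
  (oneₚ -ₚ X^ d) +ₚ (X^ d *ₚ ((oneₚ -ₚ X^ d) *ₚ G))
    ≈⟨ factor-out (X^ d) G ⟩
  (oneₚ -ₚ X^ d) *ₚ (oneₚ +ₚ (X^ d *ₚ G))
    ∎
  where
  G : Poly
  G = geometricSum d m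
  telescope : ∀ u v → (oneₚ -ₚ (u *ₚ v)) ≋ ((oneₚ -ₚ u) +ₚ (u *ₚ (oneₚ -ₚ v)))
  telescope = solve-∀ ℤ[x]-almost
  factor-out : ∀ u g → ((oneₚ -ₚ u) +ₚ (u *ₚ ((oneₚ -ₚ u) *ₚ g))) ≋ ((oneₚ -ₚ u) *ₚ (oneₚ +ₚ (u *ₚ g)))
  factor-out = solve-∀ ℤ[x]-almost

∣ₚ-respʳ-≋ : ∀ d {f g} → f ≋ g → d ∣ₚ g → d ∣ₚ f
∣ₚ-respʳ-≋ d {g = g} f≋g (h , g≈dh) = h , coeff-≡ (≋-trans f≋g (mk≋ {g} {d *ₚ h} g≈dh))

∣ₚ-*ₚ : ∀ d e f g → d ∣ₚ f → e ∣ₚ g → (d *ₚ e) ∣ₚ (f *ₚ g)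
∣ₚ-*ₚ d e f g (h , f≈dh) (h′ , g≈eh′) = h *ₚ h′ , coeff-≡ (≋-trans
  (*ₚ-cong (mk≋ {f} {d *ₚ h} f≈dh) (mk≋ {g} {e *ₚ h′} g≈eh′)) (regroup d h e h′))
  where
  regroup : ∀ d h e h′ → ((d *ₚ h) *ₚ (e *ₚ h′)) ≋ ((d *ₚ e) *ₚ (h *ₚ h′))
  regroup = solve-∀ ℤ[x]-almost

∣ₚ-*ₚʳ : ∀ d f g → d ∣ₚ f → d ∣ₚ (f *ₚ g)
∣ₚ-*ₚʳ d f g (h , f≈dh) = h *ₚ g , coeff-≡ (≋-trans
  (*ₚ-cong (mk≋ {f} {d *ₚ h} f≈dh) (≋-refl {g})) (*ₚ-assoc d h g))

one-X^∣one-X^-* : ∀ d m → (oneₚ -ₚ X^ d) ∣ₚ (oneₚ -ₚ X^ (d * m))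
one-X^∣one-X^-* d m = geometricSum d m , coeff-≡ (one-X^-*-factorisation d m)

shifted-congruence : ∀ p q m n {i j r} → i ≡ suc (q * m) → j ≡ suc (p * n) → r ≡ suc (q * m + p * n) →
  ((oneₚ -ₚ X^ i) +ₚ (X^ r -ₚ X^ j)) ≡ (oneₚ -ₚ X^ 1) [modₚ ((oneₚ -ₚ X^ p) *ₚ (oneₚ -ₚ X^ q)) ]
shifted-congruence p q m n refl refl refl =
  ∣ₚ-respʳ-≋ (P *ₚ Q) difference
    (∣ₚ-*ₚʳ (P *ₚ Q) (Pⁿ *ₚ Qᵐ) x (∣ₚ-*ₚ P Q Pⁿ Qᵐ (one-X^∣one-X^-* p n) (one-X^∣one-X^-* q m)))
  where
  a b : ℕ
  a = q * m
  b = p * n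
  x P Q Pⁿ Qᵐ : Poly
  x  = X^ 1
  P  = oneₚ -ₚ X^ p
  Q  = oneₚ -ₚ X^ q
  Pⁿ = oneₚ -ₚ X^ b
  Qᵐ = oneₚ -ₚ X^ a
  expand : ∀ x u v → ((oneₚ -ₚ (x *ₚ u)) +ₚ ((x *ₚ (u *ₚ v)) -ₚ (x *ₚ v))) -ₚ (oneₚ -ₚ x)
                     ≋ ((oneₚ -ₚ v) *ₚ (oneₚ -ₚ u)) *ₚ x
  expand = solve-∀ ℤ[x]-almost
  difference : ((oneₚ -ₚ X^ (suc a)) +ₚ (X^ (suc (a + b)) -ₚ X^ (suc b))) -ₚ (oneₚ -ₚ x)
               ≋ (Pⁿ *ₚ Qᵐ) *ₚ x
  difference = begin
    ((oneₚ -ₚ X^ (suc a)) +ₚ (X^ (suc (a + b)) -ₚ X^ (suc b))) -ₚ (oneₚ -ₚ x)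
      ≈⟨ +ₚ-cong (+ₚ-cong (+ₚ-cong (≋-refl {oneₚ}) (-ₚ‿cong (X^-+ 1 a)))
                           (+ₚ-cong (≋-trans (X^-+ 1 (a + b)) (*ₚ-cong (≋-refl {x}) (X^-+ a b)))
                                    (-ₚ‿cong (X^-+ 1 b))))
                 (≋-refl { -ₚ (oneₚ -ₚ x)}) ⟩
    ((oneₚ -ₚ (x *ₚ X^ a)) +ₚ ((x *ₚ (X^ a *ₚ X^ b)) -ₚ (x *ₚ X^ b))) -ₚ (oneₚ -ₚ x)
      ≈⟨ expand x (X^ a) (X^ b) ⟩
    (Pⁿ *ₚ Qᵐ) *ₚ x
      ∎

mainTheorem17 : (p q : ℕ) → (pp : Prime p) → (pq : Prime q) → p ≢ q →
    ∀ (k l : ℕ) →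
    IsBracket 1 p q {{prime⇒nonZero pq}} k →
    IsBracket 1 q p {{prime⇒nonZero pp}} l →
    ((oneₚ -ₚ X^ (p * k)) +ₚ (X^ (p * q) -ₚ X^ (q * l)))
      ≡ (oneₚ -ₚ X^ 1) [modₚ ((oneₚ -ₚ X^ p) *ₚ (oneₚ -ₚ X^ q)) ]
mainTheorem17 p q p-prime q-prime p≢q k l k-bracket l-bracket
  = shifted-congruence p q m n pk≡1+qm ql≡1+pn pq≡1+qm+pn
  where
  instance
    _ : NonZero p
    _ = prime⇒nonZero p-prime
    _ : NonZero q
    _ = prime⇒nonZero q-prime
  m n : ℕ
  m = k * p / q
  n = l * q / p
  kp≡1+mq : k * p ≡ suc (m * q)
  kp≡1+mq = IsBracket-1⇒k*b≡1+[k*b/m]*m (nonTrivial⇒n>1 q {{prime⇒nonTrivial q-prime}}) k-bracket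
  lq≡1+np : l * q ≡ suc (n * p)
  lq≡1+np = IsBracket-1⇒k*b≡1+[k*b/m]*m (nonTrivial⇒n>1 p {{prime⇒nonTrivial p-prime}}) l-bracket
  k+n≡q : k + n ≡ q
  k+n≡q = inverses-sum {m = m} {n = n} q-prime (prime∤prime p-prime q-prime p≢q)
                       (IsBracket⇒< k-bracket) (IsBracket⇒< l-bracket) kp≡1+mq lq≡1+np
  pk≡1+qm : p * k ≡ suc (q * m)
  pk≡1+qm = trans (ℕ.*-comm p k) (trans kp≡1+mq (cong suc (ℕ.*-comm m q)))
  ql≡1+pn : q * l ≡ suc (p * n)
  ql≡1+pn = trans (ℕ.*-comm q l) (trans lq≡1+np (cong suc (ℕ.*-comm n p)))
  pq≡1+qm+pn : p * q ≡ suc (q * m + p * n)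
  pq≡1+qm+pn = trans (cong (p *_) (sym k+n≡q)) (trans (ℕ.*-distribˡ-+ p k n) (cong (_+ p * n) pk≡1+qm))
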